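{- Let $k$ be sufficiently large and $r=o(\log k)$. For every graph $G$ in the support of $\mathcal{D}^{\mathrm{apx}}_r$, every maximum matching $\Gamma$ of $G$ satisfies \[ |\Gamma| \ge \frac{n_r}{2k}\Big(1-\sum_{t\in[r]}\frac{f_t}{p_t}\Big) \ge \frac{n_r}{4k}. \]
   Context: Distributions (parameter $k$): $\mathcal{D}^{\mathrm{apx}}_0$ on $n_0=2k$ vertices: two disjoint sets $U,V$ of size $k$, and a single edge $(u,v)$ with $u\in U$, $v\in V$ uniform and independent. For $r\ge1$: $f_r=k^6n_{r-1}^3$, $p_r=k^6n_{r-1}^3 f_r$, $n_r=(n_{r-1}-1)f_r+n_{r-1}p_r$; on a vertex set $V$ of size $n_r$, partition $V$ into principal blocks $P_1,\dots,P_{p_r}$ of size $n_{r-1}$ and fooling blocks $F_1,\dots,F_{f_r}$ of size $n_{r-1}-1$; place an independent $\mathcal{D}^{\mathrm{apx}}_{r-1}$ instance on each $P_i$; for each principal vertex $u$ and each $j$, sample an independent $\mathcal{D}^{\mathrm{apx}}_{r-1}$ instance on $F_j\cup\{u\}$ and keep only the edges incident to $u$; finally relabel by a uniformly random permutation of $V$. -}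

module Defs where

open import Data.Nat as ℕ using (ℕ; zero; suc; _+_; _*_; _∸_; _^_; _≤_; _<_)
open import Data.Fin using (Fin; toℕ; _≟_)
open import Data.Bool using (Bool; true; false; if_then_else_; _∧_; _∨_)
open import Data.Maybe using (Maybe; just; nothing)
open import Data.Product using (Σ; _×_; _,_; ∃; ∃-syntax)
open import Data.Sum using (_⊎_; inj₁; inj₂)
open import Data.List using (List; length)
open import Data.List.Relation.Unary.All using (All)
open import Data.List.Relation.Unary.AllPairs using (AllPairs)
open import Data.Integer using (+_)
open import Data.Rational as ℚ using (ℚ)
open import Relation.Nullary using (¬_; does)
open import Relation.Binary.PropositionalEquality using (_≡_)
open import Function.Bundles using (_↔_; Inverse)

Graph : ℕ → Set
Graph n = Fin n → Fin n → Bool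

Edge : ∀ {n} → Graph n → Fin n × Fin n → Set
Edge G (u , v) = G u v ≡ true

VertexDisjoint : ∀ {n} → Fin n × Fin n → Fin n × Fin n → Set
VertexDisjoint (u , v) (u' , v') =
  ¬ u ≡ u' × ¬ u ≡ v' × ¬ v ≡ u' × ¬ v ≡ v'

IsMatching : ∀ {n} → Graph n → List (Fin n × Fin n) → Set
IsMatching G M = All (Edge G) M × AllPairs VertexDisjoint M

IsMaximumMatching : ∀ {n} → Graph n → List (Fin n × Fin n) → Set
IsMaximumMatching G M =
  IsMatching G M × (∀ M' → IsMatching G M' → length M' ≤ length M)

-- Parameters (all depend on k).  m stands for n_{r-1}.

fF : ℕ → ℕ → ℕ
fF k m = k ^ 6 * m ^ 3

pF : ℕ → ℕ → ℕ
pF k m = k ^ 6 * m ^ 3 * fF k m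

nr : ℕ → ℕ → ℕ
nr k zero    = 2 * k
nr k (suc r) = (nr k r ∸ 1) * fF k (nr k r) + nr k r * pF k (nr k r)

f-at p-at : ℕ → ℕ → ℕ     -- f_t, p_t for t ≥ 1 (index t = suc s)
f-at k s = fF k (nr k s)
p-at k s = pF k (nr k s)

-- level 0: vertex set Fin (2k), U = {0..k-1}, V = {k..2k-1},
-- a single edge {u,v} with u ∈ U, v ∈ V.
Supp0 : (k : ℕ) → Graph (2 * k) → Set
Supp0 k G = Σ (Fin (2 * k)) λ u → Σ (Fin (2 * k)) λ v →
  toℕ u < k × k ≤ toℕ v ×
  (∀ x y → G x y ≡ ((does (x ≟ u) ∧ does (y ≟ v)) ∨ (does (x ≟ v) ∧ does (y ≟ u))))

-- Structured vertex set of level r: principal blocks P_i (i < p) of size m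
-- and fooling blocks F_j (j < f) of size m - 1.
StructV : ℕ → ℕ → ℕ → Set
StructV m p f = (Fin p × Fin m) ⊎ (Fin f × Fin (m ∸ 1))

StructE : ∀ {m p f} (H : Fin p → Graph m) (K : Fin p → Fin m → Fin f → Graph m)
  (emb : Fin p → Fin m → Fin f → Fin m ↔ Maybe (Fin (m ∸ 1)))
  → StructV m p f → StructV m p f → Bool
StructE H K emb (inj₁ (i , a)) (inj₁ (i' , b)) = does (i ≟ i') ∧ H i a b
StructE H K emb (inj₁ (i , a)) (inj₂ (j , c))  =
  K i a j (Inverse.from (emb i a j) nothing) (Inverse.from (emb i a j) (just c))
StructE H K emb (inj₂ (j , c)) (inj₁ (i , a))  =
  K i a j (Inverse.from (emb i a j) (just c)) (Inverse.from (emb i a j) nothing)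
StructE H K emb (inj₂ _) (inj₂ _) = false

record Step (m p f : ℕ) (Prev : Graph m → Set) (n : ℕ) (G : Graph n) : Set where
  field
    H    : Fin p → Graph m
    H∈   : ∀ i → Prev (H i)
    -- for principal vertex u = (i,a) and fooling block j: an instance on F_j ∪ {u}
    -- (only its edges incident to u are kept, see StructE)
    K    : Fin p → Fin m → Fin f → Graph m
    K∈   : ∀ i a j → Prev (K i a j)
    -- identification of Fin m with F_j ∪ {u}  (nothing = the principal vertex u)
    emb  : Fin p → Fin m → Fin f → Fin m ↔ Maybe (Fin (m ∸ 1))
    π    : Fin n ↔ StructV m p f
    G≡   : ∀ x y → G x y ≡ StructE H K emb (Inverse.to π x) (Inverse.to π y)

Supp : (k r : ℕ) → Graph (nr k r) → Set
Supp k zero    G = Supp0 k G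
Supp k (suc r) G = Step (nr k r) (pF k (nr k r)) (fF k (nr k r)) (Supp k r) (nr k (suc r)) G

-- a / b as a rational; (convention: 0 when b = 0, never used for k ≥ 1)
_//_ : ℕ → ℕ → ℚ
a // zero  = ℚ.0ℚ
a // suc b = (+ a) ℚ./ suc b

sumFP : ℕ → ℕ → ℚ
sumFP k zero    = ℚ.0ℚ
sumFP k (suc s) = sumFP k s ℚ.+ (f-at k s // p-at k s)

bound : ℕ → ℕ → ℚ
bound k r = (nr k r // (2 * k)) ℚ.* (ℚ.1ℚ ℚ.- sumFP k r)

toℚ : ℕ → ℚ
toℚ a = (+ a) ℚ./ 1

-- The principal blocks of a graph in the support of D^apx_r are vertex-disjoint
-- copies of graphs in the support of D^apx_{r−1}, so by induction every such graph has a
-- matching of size p_1 ⋯ p_r (a single edge at level 0), and so has every maximum matching.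
-- Passing from level r to r + 1 multiplies this size by p_{r+1}, while n_{r+1}/2k exceeds
-- p_{r+1} n_r/2k by the mass (n_r − 1) f_{r+1}/2k of the fooling vertices; that excess is
-- paid for by the new summand f_{r+1}/p_{r+1}. For the second inequality, f_t/p_t =
-- 1/(k⁶ n_{t−1}³) ≤ 1/2k and r ≤ log₂ k ≤ k, so the sum is at most 1/2.

module Submission where

open import Defs
open import Data.Nat as ℕ using (ℕ; zero; suc; _+_; _*_; _∸_; _^_; _≤_; NonZero)
import Data.Nat.Properties as ℕP
open import Data.Nat.Logarithm using (⌊log₂_⌋; ⌊log₂⌋-mono-≤; ⌊log₂[2^n]⌋≡n)
open import Data.Nat.Tactic.RingSolver using (solve)
open import Data.Integer as ℤ using (+_)
import Data.Integer.Properties as ℤP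
open import Data.Rational as ℚ using (ℚ; 0ℚ; 1ℚ; ½)
import Data.Rational.Properties as ℚP
open import Data.Rational.Solver using (module +-*-Solver)
open import Data.Rational.Unnormalised as ℚᵘ using (mkℚᵘ; *≡*; *≤*)
import Data.Rational.Unnormalised.Properties as ℚᵘP
open import Data.Fin as Fin using (Fin; _≟_)
open import Data.Bool using (true)
open import Data.Product as Prod using (Σ-syntax; _×_; _,_; proj₁; proj₂; ∃-syntax)
open import Data.Sum using (inj₁)
open import Data.Sum.Properties using (inj₁-injective)
open import Data.List using (List; []; _∷_; _++_; map; concat; tabulate; length)
open import Data.List.Properties using (length-++; length-map)
open import Data.List.Relation.Unary.All as All using (All)
import Data.List.Relation.Unary.All.Properties as All
import Data.List.Relation.Unary.AllPairs as AllPairs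
import Data.List.Relation.Unary.AllPairs.Properties as AllPairs
open import Function using (_∘_)
open import Function.Bundles using (Inverse; Injection)
open import Function.Construct.Symmetry using (↔-sym)
open import Function.Properties.Inverse using (↔⇒↣)
open import Relation.Nullary.Decidable using (dec-true)
open import Relation.Binary.PropositionalEquality

MatchingOfSize : ∀ {n} → Graph n → ℕ → Set
MatchingOfSize {n} G c = Σ[ M ∈ List (Fin n × Fin n) ] IsMatching G M × length M ≡ c

matchingSize≤maximum : ∀ {n} {G : Graph n} {Γ c} →
  IsMaximumMatching G Γ → MatchingOfSize G c → c ≤ length Γ
matchingSize≤maximum (_ , maximal) (M , isMatching , refl) = maximal M isMatching

edge-matching : ∀ {n} {G : Graph n} {e} → Edge G e → MatchingOfSize G 1
edge-matching {e = e} e∈G = e ∷ [] , (e∈G All.∷ All.[] , All.[] AllPairs.∷ AllPairs.[]) , refl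

length-concat-tabulate : ∀ {A : Set} {p c} (L : Fin p → List A) →
  (∀ i → length (L i) ≡ c) → length (concat (tabulate L)) ≡ p * c
length-concat-tabulate {p = zero}  L len = refl
length-concat-tabulate {p = suc p} {c} L len = begin
  length (L Fin.zero ++ concat (tabulate (L ∘ Fin.suc)))
    ≡⟨ length-++ (L Fin.zero) ⟩
  length (L Fin.zero) + length (concat (tabulate (L ∘ Fin.suc)))
    ≡⟨ cong₂ _+_ (len Fin.zero) (length-concat-tabulate (L ∘ Fin.suc) (len ∘ Fin.suc)) ⟩
  c + p * c ∎
  where open ≡-Reasoning

module _ {m n p} {G : Graph n} {H : Fin p → Graph m} (ι : Fin p → Fin m → Fin n)
  (ι-injective : ∀ {i j a b} → ι i a ≡ ι j b → i ≡ j × a ≡ b)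
  (ι-edge : ∀ i {a b} → H i a b ≡ true → G (ι i a) (ι i b) ≡ true) where

  private
    ι² : Fin p → Fin m × Fin m → Fin n × Fin n
    ι² i = Prod.map (ι i) (ι i)

    sameBlock : ∀ {i j a b} → ι i a ≡ ι j b → i ≡ j
    sameBlock = proj₁ ∘ ι-injective

    sameVertex : ∀ {i a b} → ι i a ≡ ι i b → a ≡ b
    sameVertex = proj₂ ∘ ι-injective

  embedded-matching : ∀ i {M} → IsMatching (H i) M → IsMatching G (map (ι² i) M)
  embedded-matching i (edges , disjoint) =
      All.map⁺ (All.map (ι-edge i) edges)
    , AllPairs.map⁺ (AllPairs.map
        (λ (d₁ , d₂ , d₃ , d₄) → d₁ ∘ sameVertex , d₂ ∘ sameVertex , d₃ ∘ sameVertex , d₄ ∘ sameVertex)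
        disjoint)

  embedded-blocks-disjoint : ∀ {i j} → i ≢ j → ∀ M M' →
    All (λ e → All (VertexDisjoint e) (map (ι² j) M')) (map (ι² i) M)
  embedded-blocks-disjoint i≢j M M' = All.map⁺ (All.universal
    (λ _ → All.map⁺ (All.universal
      (λ _ → i≢j ∘ sameBlock , i≢j ∘ sameBlock , i≢j ∘ sameBlock , i≢j ∘ sameBlock) M')) M)

  concat-embedded-matching : ∀ {c} → (∀ i → MatchingOfSize (H i) c) → MatchingOfSize G (p * c)
  concat-embedded-matching matchings =
      concat (tabulate blocks)
    , ( All.concat⁺ (All.tabulate⁺ (proj₁ ∘ isMatching))
      , AllPairs.concat⁺ (All.tabulate⁺ (proj₂ ∘ isMatching))
          (AllPairs.tabulate⁺ (λ i≢j → embedded-blocks-disjoint i≢j _ _)))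
    , length-concat-tabulate blocks
        (λ i → trans (length-map (ι² i) (proj₁ (matchings i))) (proj₂ (proj₂ (matchings i))))
    where
    blocks : Fin p → List (Fin n × Fin n)
    blocks i = map (ι² i) (proj₁ (matchings i))
    isMatching : ∀ i → IsMatching G (blocks i)
    isMatching i = embedded-matching i (proj₁ (proj₂ (matchings i)))

principalProduct : ℕ → ℕ → ℕ
principalProduct k zero    = 1
principalProduct k (suc r) = p-at k r * principalProduct k r

supp-matching : ∀ k r {G} → Supp k r G → MatchingOfSize G (principalProduct k r)
supp-matching k zero {G} (u , v , _ , _ , G≡) = edge-matching uv∈G
  where
  uv∈G : G u v ≡ true
  uv∈G rewrite G≡ u v | dec-true (u ≟ u) refl | dec-true (v ≟ v) refl = refl
supp-matching k (suc r) {G} s = concat-embedded-matching ι ι-injective ι-edge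
  (λ i → supp-matching k r (H∈ i))
  where
  open Step s
  ι : Fin (p-at k r) → Fin (nr k r) → Fin (nr k (suc r))
  ι i a = Inverse.from π (inj₁ (i , a))
  ι-injective : ∀ {i j a b} → ι i a ≡ ι j b → i ≡ j × a ≡ b
  ι-injective e with inj₁-injective (Injection.injective (↔⇒↣ (↔-sym π)) e)
  ... | refl = refl , refl
  ι-edge : ∀ i {a b} → H i a b ≡ true → G (ι i a) (ι i b) ≡ true
  ι-edge i {a} {b} Hab rewrite G≡ (ι i a) (ι i b)
    | Inverse.strictlyInverseˡ π (inj₁ (i , a)) | Inverse.strictlyInverseˡ π (inj₁ (i , b))
    | dec-true (i ≟ i) refl = Hab

toℚᵘ-// : ∀ a b → ℚ.toℚᵘ (a // suc b) ℚᵘ.≃ mkℚᵘ (+ a) b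
toℚᵘ-// a b = ℚP.toℚᵘ-fromℚᵘ (mkℚᵘ (+ a) b)

//-cong : ∀ a b c d .{{_ : NonZero b}} .{{_ : NonZero d}} → a * d ≡ c * b → a // b ≡ c // d
//-cong a (suc b) c (suc d) ad≡cb = ℚP.toℚᵘ-injective (begin
  ℚ.toℚᵘ (a // suc b) ≈⟨ toℚᵘ-// a b ⟩
  mkℚᵘ (+ a) b        ≈⟨ *≡* (trans (sym (ℤP.pos-* a (suc d)))
                                    (trans (cong +_ ad≡cb) (ℤP.pos-* c (suc b)))) ⟩
  mkℚᵘ (+ c) d        ≈⟨ ℚᵘP.≃-sym (toℚᵘ-// c d) ⟩
  ℚ.toℚᵘ (c // suc d) ∎)
  where open ℚᵘP.≃-Reasoning

//-mono-≤ : ∀ a b c d .{{_ : NonZero b}} .{{_ : NonZero d}} → a * d ≤ c * b → a // b ℚ.≤ c // d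
//-mono-≤ a (suc b) c (suc d) ad≤cb = ℚP.toℚᵘ-cancel-≤ (begin
  ℚ.toℚᵘ (a // suc b) ≃⟨ toℚᵘ-// a b ⟩
  mkℚᵘ (+ a) b        ≤⟨ *≤* (subst₂ ℤ._≤_ (ℤP.pos-* a (suc d)) (ℤP.pos-* c (suc b)) (ℤ.+≤+ ad≤cb)) ⟩
  mkℚᵘ (+ c) d        ≃⟨ ℚᵘP.≃-sym (toℚᵘ-// c d) ⟩
  ℚ.toℚᵘ (c // suc d) ∎)
  where open ℚᵘP.≤-Reasoning

//-+ : ∀ a b c d .{{_ : NonZero b}} .{{_ : NonZero d}} → (a // b) ℚ.+ (c // d) ≡ (a * d + c * b) // (b * d)
//-+ a (suc b) c (suc d) = ℚP.toℚᵘ-injective (begin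
  ℚ.toℚᵘ ((a // suc b) ℚ.+ (c // suc d))                 ≈⟨ ℚP.toℚᵘ-homo-+ (a // suc b) (c // suc d) ⟩
  ℚ.toℚᵘ (a // suc b) ℚᵘ.+ ℚ.toℚᵘ (c // suc d)           ≈⟨ ℚᵘP.+-cong (toℚᵘ-// a b) (toℚᵘ-// c d) ⟩
  mkℚᵘ (+ a ℤ.* + suc d ℤ.+ + c ℤ.* + suc b) _           ≡⟨ cong (λ z → mkℚᵘ z _) numerator ⟩
  mkℚᵘ (+ (a * suc d + c * suc b)) _                     ≈⟨ ℚᵘP.≃-sym (toℚᵘ-// _ _) ⟩
  ℚ.toℚᵘ ((a * suc d + c * suc b) // (suc b * suc d))   ∎)
  where
  open ℚᵘP.≃-Reasoning
  numerator : + a ℤ.* + suc d ℤ.+ + c ℤ.* + suc b ≡ + (a * suc d + c * suc b)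
  numerator = trans (cong₂ ℤ._+_ (sym (ℤP.pos-* a (suc d))) (sym (ℤP.pos-* c (suc b))))
                    (sym (ℤP.pos-+ (a * suc d) (c * suc b)))

//-* : ∀ a b c d .{{_ : NonZero b}} .{{_ : NonZero d}} → (a // b) ℚ.* (c // d) ≡ (a * c) // (b * d)
//-* a (suc b) c (suc d) = ℚP.toℚᵘ-injective (begin
  ℚ.toℚᵘ ((a // suc b) ℚ.* (c // suc d))        ≈⟨ ℚP.toℚᵘ-homo-* (a // suc b) (c // suc d) ⟩
  ℚ.toℚᵘ (a // suc b) ℚᵘ.* ℚ.toℚᵘ (c // suc d)  ≈⟨ ℚᵘP.*-cong (toℚᵘ-// a b) (toℚᵘ-// c d) ⟩
  mkℚᵘ (+ a ℤ.* + c) _                          ≡⟨ cong (λ z → mkℚᵘ z _) (sym (ℤP.pos-* a c)) ⟩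
  mkℚᵘ (+ (a * c)) _                            ≈⟨ ℚᵘP.≃-sym (toℚᵘ-// _ _) ⟩
  ℚ.toℚᵘ ((a * c) // (suc b * suc d))          ∎)
  where open ℚᵘP.≃-Reasoning

0≤// : ∀ a b → 0ℚ ℚ.≤ a // b
0≤// a zero    = ℚP.≤-refl
0≤// a (suc b) = //-mono-≤ 0 1 a (suc b) ℕ.z≤n

//-+-sameDenom : ∀ a b d .{{_ : NonZero d}} → (a // d) ℚ.+ (b // d) ≡ (a + b) // d
//-+-sameDenom a b d = trans (//-+ a d b d) (//-cong (a * d + b * d) (d * d) (a + b) d {{ℕP.m*n≢0 d d}}
  (solve (a ∷ b ∷ d ∷ [])))

toℚ-*-// : ∀ a b d .{{_ : NonZero d}} → toℚ a ℚ.* (b // d) ≡ (a * b) // d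
toℚ-*-// a b d = trans (//-* a 1 b d) (cong ((a * b) //_) (ℕP.*-identityˡ d))

toℚ-mono-≤ : ∀ {m n} → m ≤ n → toℚ m ℚ.≤ toℚ n
toℚ-mono-≤ {m} {n} m≤n = //-mono-≤ m 1 n 1 (ℕP.*-monoˡ-≤ 1 m≤n)

//-*-½ : ∀ a d .{{_ : NonZero d}} → (a // d) ℚ.* ½ ≡ a // (2 * d)
//-*-½ a d = trans (//-* a d 1 2) (//-cong (a * 1) (d * 2) a (2 * d) {{ℕP.m*n≢0 d 2}} {{ℕP.m*n≢0 2 d}}
  (solve (a ∷ d ∷ [])))

0≤* : ∀ {x y} → 0ℚ ℚ.≤ x → 0ℚ ℚ.≤ y → 0ℚ ℚ.≤ x ℚ.* y
0≤* {x} {y} 0≤x 0≤y = ℚP.nonNegative⁻¹ (x ℚ.* y)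
  {{ℚP.nonNeg*nonNeg⇒nonNeg x {{ℚ.nonNegative 0≤x}} y {{ℚ.nonNegative 0≤y}}}}

p≤p+q : ∀ x {y} → 0ℚ ℚ.≤ y → x ℚ.≤ x ℚ.+ y
p≤p+q x {y} 0≤y = subst (ℚ._≤ x ℚ.+ y) (ℚP.+-identityʳ x) (ℚP.+-monoʳ-≤ x 0≤y)

-- In bound-step, e = (n − 1)f/2k is the mass of the fooling vertices and c = n/2k; the loss
-- P c q = nf/2k caused by the new summand q = f/p outweighs e.
bound-recurrence : ∀ {e c P q S} → 0ℚ ℚ.≤ e → 0ℚ ℚ.≤ S → 0ℚ ℚ.≤ q → e ℚ.≤ P ℚ.* c ℚ.* q →
  (e ℚ.+ P ℚ.* c) ℚ.* (1ℚ ℚ.- (S ℚ.+ q)) ℚ.≤ P ℚ.* (c ℚ.* (1ℚ ℚ.- S))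
bound-recurrence {e} {c} {P} {q} {S} 0≤e 0≤S 0≤q e≤Pcq = begin
  (e ℚ.+ P ℚ.* c) ℚ.* (1ℚ ℚ.- (S ℚ.+ q))
    ≤⟨ p≤p+q _ (0≤* 0≤e (ℚP.+-mono-≤ 0≤S 0≤q)) ⟩
  (e ℚ.+ P ℚ.* c) ℚ.* (1ℚ ℚ.- (S ℚ.+ q)) ℚ.+ e ℚ.* (S ℚ.+ q)
    ≡⟨ expand e c P q S ⟩
  e ℚ.+ (Z ℚ.- P ℚ.* c ℚ.* q)
    ≤⟨ ℚP.+-monoˡ-≤ _ e≤Pcq ⟩
  P ℚ.* c ℚ.* q ℚ.+ (Z ℚ.- P ℚ.* c ℚ.* q)
    ≡⟨ cancel (P ℚ.* c ℚ.* q) Z ⟩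
  Z ∎
  where
  open ℚP.≤-Reasoning
  open +-*-Solver renaming (solve to ℚ-solve)
  Z : ℚ
  Z = P ℚ.* (c ℚ.* (1ℚ ℚ.- S))
  expand : ∀ e c P q S → (e ℚ.+ P ℚ.* c) ℚ.* (1ℚ ℚ.- (S ℚ.+ q)) ℚ.+ e ℚ.* (S ℚ.+ q)
                         ≡ e ℚ.+ (P ℚ.* (c ℚ.* (1ℚ ℚ.- S)) ℚ.- P ℚ.* c ℚ.* q)
  expand = ℚ-solve 5 (λ e c P q S →
    (e :+ P :* c) :* (con 1ℚ :- (S :+ q)) :+ e :* (S :+ q)
      := e :+ (P :* (c :* (con 1ℚ :- S)) :- P :* c :* q)) refl
  cancel : ∀ x z → x ℚ.+ (z ℚ.- x) ≡ z
  cancel = ℚ-solve 2 (λ x z → x :+ (z :- x) := z) refl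

-- For D = 2k, n = n_r, f = f_{r+1}, p = p_{r+1}, S = Σ_{t≤r} f_t/p_t this is the step from
-- bound k r to bound k (r + 1).
bound-step : ∀ D n f p M S .{{_ : NonZero D}} .{{_ : NonZero p}} → 0ℚ ℚ.≤ S →
  (n // D) ℚ.* (1ℚ ℚ.- S) ℚ.≤ toℚ M →
  (((n ∸ 1) * f + n * p) // D) ℚ.* (1ℚ ℚ.- (S ℚ.+ f // p)) ℚ.≤ toℚ (p * M)
bound-step D n f p M S 0≤S ih = begin
  (((n ∸ 1) * f + n * p) // D) ℚ.* (1ℚ ℚ.- (S ℚ.+ q))
    ≡⟨ cong (ℚ._* (1ℚ ℚ.- (S ℚ.+ q))) split ⟩
  (e ℚ.+ P ℚ.* c) ℚ.* (1ℚ ℚ.- (S ℚ.+ q))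
    ≤⟨ bound-recurrence {e} {c} {P} {q} {S} (0≤// _ D) 0≤S (0≤// f p) e≤Pcq ⟩
  P ℚ.* (c ℚ.* (1ℚ ℚ.- S))
    ≤⟨ ℚP.*-monoˡ-≤-nonNeg P {{ℚ.nonNegative (0≤// p 1)}} ih ⟩
  P ℚ.* toℚ M
    ≡⟨ toℚ-*-// p M 1 ⟩
  toℚ (p * M) ∎
  where
  open ℚP.≤-Reasoning
  instance _ = ℕP.m*n≢0 D p
  e c P q : ℚ
  e = ((n ∸ 1) * f) // D
  c = n // D
  P = toℚ p
  q = f // p
  split : ((n ∸ 1) * f + n * p) // D ≡ e ℚ.+ P ℚ.* c
  split = sym (begin-equality
    e ℚ.+ P ℚ.* c               ≡⟨ cong (e ℚ.+_) (trans (toℚ-*-// p n D) (cong (_// D) (ℕP.*-comm p n))) ⟩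
    e ℚ.+ (n * p) // D          ≡⟨ //-+-sameDenom ((n ∸ 1) * f) (n * p) D ⟩
    ((n ∸ 1) * f + n * p) // D  ∎)
  e≤Pcq : e ℚ.≤ P ℚ.* c ℚ.* q
  e≤Pcq = begin
    e                            ≤⟨ //-mono-≤ _ D (n * f) D (ℕP.*-monoˡ-≤ D (ℕP.*-monoˡ-≤ f (ℕP.m∸n≤m n 1))) ⟩
    (n * f) // D                 ≡⟨ //-cong (n * f) D (p * n * f) (D * p) (solve (n ∷ f ∷ D ∷ p ∷ [])) ⟩
    (p * n * f) // (D * p)       ≡⟨ sym (//-* (p * n) D f p) ⟩
    ((p * n) // D) ℚ.* q         ≡⟨ cong (ℚ._* q) (sym (toℚ-*-// p n D)) ⟩
    P ℚ.* c ℚ.* q                ∎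

nonZero-mono : ∀ {m n} .{{_ : NonZero m}} → m ≤ n → NonZero n
nonZero-mono {m} m≤n = ℕ.>-nonZero (ℕP.<-≤-trans (ℕ.>-nonZero⁻¹ m) m≤n)

fF-nonZero : ∀ k m .{{_ : NonZero k}} .{{_ : NonZero m}} → NonZero (fF k m)
fF-nonZero k m = ℕP.m*n≢0 (k ^ 6) (m ^ 3) {{ℕP.m^n≢0 k 6}} {{ℕP.m^n≢0 m 3}}

-- pF k m is definitionally fF k m * fF k m.
pF-nonZero : ∀ k m .{{_ : NonZero k}} .{{_ : NonZero m}} → NonZero (pF k m)
pF-nonZero k m = ℕP.m*n≢0 (fF k m) (fF k m) {{fF-nonZero k m}} {{fF-nonZero k m}}

2k≤nr : ∀ k r .{{_ : NonZero k}} → 2 * k ≤ nr k r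
2k≤nr k zero            = ℕP.≤-refl
2k≤nr k@(suc _) (suc r) = ℕP.≤-trans (2k≤nr k r) (ℕP.≤-trans n≤n*p (ℕP.m≤n+m _ _))
  where
  instance _ = nonZero-mono (2k≤nr k r)
  n≤n*p : nr k r ≤ nr k r * pF k (nr k r)
  n≤n*p = ℕP.m≤m*n (nr k r) (pF k (nr k r)) {{pF-nonZero k (nr k r)}}

nr-nonZero : ∀ k r .{{_ : NonZero k}} → NonZero (nr k r)
nr-nonZero k@(suc _) r = nonZero-mono (2k≤nr k r)

0≤sumFP : ∀ k r → 0ℚ ℚ.≤ sumFP k r
0≤sumFP k zero    = ℚP.≤-refl
0≤sumFP k (suc r) = ℚP.+-mono-≤ (0≤sumFP k r) (0≤// (f-at k r) (p-at k r))

bound≤principalProduct : ∀ k r .{{_ : NonZero k}} → bound k r ℚ.≤ toℚ (principalProduct k r)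
bound≤principalProduct k@(suc _) zero =
  ℚP.≤-reflexive (cong (ℚ._* (1ℚ ℚ.- 0ℚ)) (//-cong (2 * k) (2 * k) 1 1 (ℕP.*-comm (2 * k) 1)))
bound≤principalProduct k@(suc _) (suc r) =
  bound-step (2 * k) (nr k r) (f-at k r) (p-at k r) (principalProduct k r) (sumFP k r)
    (0≤sumFP k r) (bound≤principalProduct k r)
  where
  instance
    _ = nr-nonZero k r
    _ = pF-nonZero k (nr k r)

f/p≤1/2k : ∀ k m .{{_ : NonZero k}} → 2 * k ≤ m → fF k m // pF k m ℚ.≤ 1 // (2 * k)
f/p≤1/2k k@(suc _) m 2k≤m = //-mono-≤ f (pF k m) 1 (2 * k) {{pF-nonZero k m}}
  (ℕP.≤-trans (ℕP.*-monoʳ-≤ f 2k≤f) (ℕP.≤-reflexive (sym (ℕP.*-identityˡ (f * f)))))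
  where
  instance _ = nonZero-mono 2k≤m
  f : ℕ
  f = fF k m
  2k≤f : 2 * k ≤ f
  2k≤f = ℕP.≤-trans 2k≤m (ℕP.≤-trans (ℕP.m≤m*n m (m ^ 2) {{ℕP.m^n≢0 m 2}})
                                     (ℕP.m≤n*m (m ^ 3) (k ^ 6) {{ℕP.m^n≢0 k 6}}))

sumFP≤r/2k : ∀ k r .{{_ : NonZero k}} → sumFP k r ℚ.≤ r // (2 * k)
sumFP≤r/2k k zero            = 0≤// 0 (2 * k)
sumFP≤r/2k k@(suc _) (suc r) = begin
  sumFP k r ℚ.+ f-at k r // p-at k r   ≤⟨ ℚP.+-mono-≤ (sumFP≤r/2k k r) (f/p≤1/2k k (nr k r) (2k≤nr k r)) ⟩
  r // (2 * k) ℚ.+ 1 // (2 * k)        ≡⟨ //-+-sameDenom r 1 (2 * k) ⟩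
  (r + 1) // (2 * k)                   ≡⟨ cong (_// (2 * k)) (ℕP.+-comm r 1) ⟩
  suc r // (2 * k)                     ∎
  where open ℚP.≤-Reasoning

½≤1-sumFP : ∀ k r .{{_ : NonZero k}} → r ≤ k → ½ ℚ.≤ 1ℚ ℚ.- sumFP k r
½≤1-sumFP k@(suc _) r r≤k = ℚP.+-monoʳ-≤ 1ℚ (ℚP.neg-antimono-≤ (begin
  sumFP k r      ≤⟨ sumFP≤r/2k k r ⟩
  r // (2 * k)   ≤⟨ //-mono-≤ r (2 * k) k (2 * k) (ℕP.*-monoˡ-≤ (2 * k) r≤k) ⟩
  k // (2 * k)   ≡⟨ //-cong k (2 * k) 1 2 (trans (ℕP.*-comm k 2) (sym (ℕP.*-identityˡ (2 * k)))) ⟩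
  ½              ∎))
  where open ℚP.≤-Reasoning

n/4k≤bound : ∀ k r .{{_ : NonZero k}} → r ≤ k → nr k r // (4 * k) ℚ.≤ bound k r
n/4k≤bound k@(suc _) r r≤k = begin
  nr k r // (4 * k)              ≡⟨ cong (nr k r //_) (ℕP.*-assoc 2 2 k) ⟩
  nr k r // (2 * (2 * k))        ≡⟨ sym (//-*-½ (nr k r) (2 * k)) ⟩
  (nr k r // (2 * k)) ℚ.* ½      ≤⟨ ℚP.*-monoˡ-≤-nonNeg (nr k r // (2 * k))
                                      {{ℚ.nonNegative (0≤// (nr k r) (2 * k))}} (½≤1-sumFP k r r≤k) ⟩
  bound k r                      ∎
  where open ℚP.≤-Reasoning

n≤2^n : ∀ n → n ≤ 2 ^ n
n≤2^n zero    = ℕ.z≤n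
n≤2^n (suc n) = ℕP.+-mono-≤ (ℕP.m^n>0 2 n) (ℕP.≤-trans (n≤2^n n) (ℕP.m≤m+n (2 ^ n) 0))

≤⌊log₂⌋⇒≤ : ∀ {m n} → m ≤ ⌊log₂ n ⌋ → m ≤ n
≤⌊log₂⌋⇒≤ {m} {n} m≤log = ℕP.≤-trans m≤log
  (subst (⌊log₂ n ⌋ ≤_) (⌊log₂[2^n]⌋≡n n) (⌊log₂⌋-mono-≤ (n≤2^n n)))

claim6p3 : (r : ℕ → ℕ)
    → (∀ c → ∃[ K ] (∀ k → K ≤ k → c * r k ≤ ⌊log₂ k ⌋))
    → ∃[ K ] (∀ k → K ≤ k → ∀ (G : Graph (nr k (r k))) → Supp k (r k) G
        → ∀ Γ → IsMaximumMatching G Γ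
        → (bound k (r k) ℚ.≤ toℚ (length Γ)) × ((nr k (r k) // (4 * k)) ℚ.≤ bound k (r k)))
claim6p3 r r≪log = let K , r≤log = r≪log 1 in suc K , λ where
  k@(suc _) K<k G G∈supp Γ Γ-maximum →
    let r≤k : r k ≤ k
        r≤k = ≤⌊log₂⌋⇒≤ (subst (_≤ ⌊log₂ k ⌋) (ℕP.*-identityˡ (r k)) (r≤log k (ℕP.<⇒≤ K<k)))
    in ℚP.≤-trans (bound≤principalProduct k (r k))
         (toℚ-mono-≤ (matchingSize≤maximum Γ-maximum (supp-matching k (r k) G∈supp)))
     , n/4k≤bound k (r k) r≤k
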